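{- Let $J=\{j_1<\cdots<j_r\}$ and $K=\{k_1<\cdots<k_r\}$ be subsets of $[n]$ of the same size, and let $b(J)_1<b(J)_2<\cdots<b(J)_{n-r}$ be the elements of $[n]\setminus J$. Let $A_{J,K}$ be the $n\times n$ matrix whose first $r$ rows form the block $B_{J,K}$ with $(p,j)$ entry $x_{k_p}^{\,n-j+1}$ ($1\le p\le r$, $1\le j\le n$), and whose last $n-r$ rows form the block $C_{J,K}$ with $(i,j)$ entry $h_{b(J)_i-j}(x_{b(J)_i},x_{b(J)_i+1},\dots,x_n)$ ($1\le i\le n-r$, $1\le j\le n$). Then $\mathfrak{F}_{J,K}=\pm\det(A_{J,K})$.
   Context: $h_m(\cdot)$ is the complete homogeneous symmetric polynomial of degree $m$, with $h_0=1$ and $h_m=0$ for $m<0$. Let $\mathcal{H}$ be the $n\times n$ matrix with $(i,j)$ entry $h_{i-j}(x_i,x_{i+1},\dots,x_n)$. For $K\subseteq[n]$, $K^*=\{n-k+1:k\in K\}$. $\Delta_{R,C}(\mathcal{H})$ is the minor with row set $R$ and column set $C$ (indices in increasing order). For subsets $J,K\subseteq[n]$ of the same size, $\mathfrak{F}_{J,K}=\sum_{I\subseteq[n],|I|=|J|}(-1)^{\sum_{i\in I}i}\,\Delta_{[n]-J,([n]-I)^*}(\mathcal{H})\cdot\det(x_k^i)_{k\in K,i\in I}$, where rows and columns of $\det(x_k^i)$ are indexed in increasing order. -}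

module Defs where

open import Level using (Level)
open import Algebra.Bundles using (CommutativeRing)
open import Data.Bool using (Bool; true; false; if_then_else_)
open import Data.Nat using (ℕ; zero; suc; _∸_; _≤?_; _<?_) renaming (_+_ to _+ℕ_)
open import Data.Fin using (Fin; fromℕ<)
open import Data.Fin.Subset using (Subset; ∁; ∣_∣)
open import Data.List using (List; []; _∷_; map; foldr; _++_; upTo; filter; reverse)
open import Data.Vec using (Vec) renaming ([] to []ᵛ; _∷_ to _∷ᵛ_; reverse to reverseᵛ)
open import Data.Sum using (_⊎_; inj₁; inj₂)
open import Relation.Nullary using (yes; no)
open import Relation.Binary.PropositionalEquality using (_≡_)
import Data.Nat as N

-- All subsets of [n] (as characteristic vectors, index 0 ↔ element 1).
allSubsets : ∀ n → List (Subset n)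
allSubsets zero = []ᵛ ∷ []
allSubsets (suc n) = map (true ∷ᵛ_) (allSubsets n) ++ map (false ∷ᵛ_) (allSubsets n)

elems : ∀ {n} → Subset n → List ℕ
elems []ᵛ = []
elems (b ∷ᵛ bs) = (if b then (λ l → 1 ∷ l) else (λ l → l)) (map suc (elems bs))

-- K* = { n - k + 1 : k ∈ K } : reversing the characteristic vector.
star : ∀ {n} → Subset n → Subset n
star = reverseᵛ

range : ℕ → ℕ → List ℕ
range i n = map (i +ℕ_) (upTo (suc n ∸ i))

module WithRing {c ℓ : Level} (R : CommutativeRing c ℓ) where
  open CommutativeRing R

  sum : List Carrier → Carrier
  sum = foldr _+_ 0#

  pow : Carrier → ℕ → Carrier
  pow a zero = 1#
  pow a (suc k) = a * pow a k

  neg1^ : ℕ → Carrier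
  neg1^ zero = 1#
  neg1^ (suc k) = - neg1^ k

  sign : Bool → Carrier
  sign true = 1#
  sign false = - 1#

  -- Determinant of the square matrix M restricted to the (ordered) row list
  -- and column list, by Laplace expansion along the first row.
  -- (Returns 0 when the lists have different lengths; never used that way.)
  det : ∀ {a b} {A : Set a} {B : Set b} → (A → B → Carrier) → List A → List B → Carrier
  det M [] [] = 1#
  det M [] (_ ∷ _) = 0#
  det M (_ ∷ _) [] = 0#
  det M (r ∷ rs) (c ∷ cs) = expand 0 [] c cs
    where
    -- expand k before c after : contributions of columns c, after...,
    -- where c sits at 0-based position k and 'before' (reversed) precedes it
    expand : ℕ → List _ → _ → List _ → Carrier
    expand k before c [] = neg1^ k * (M r c * det M rs (reverse before))
    expand k before c (c' ∷ after) =
      neg1^ k * (M r c * det M rs (reverse before ++ (c' ∷ after)))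
      + expand (suc k) (c ∷ before) c' after

  h : ℕ → List Carrier → Carrier
  h zero ys = 1#
  h (suc m) [] = 0#
  h (suc m) (y ∷ ys) = y * h m (y ∷ ys) + h (suc m) ys

  module Vars {n : ℕ} (x : Fin n → Carrier) where
    -- x_k for 1-based k ∈ [n] (0 outside; never used outside [n])
    xAt : ℕ → Carrier
    xAt zero = 0#
    xAt (suc k) with k <? n
    ... | yes p = x (fromℕ< p)
    ... | no _ = 0#

    𝓗 : ℕ → ℕ → Carrier
    𝓗 i j with j ≤? i
    ... | yes _ = h (i ∸ j) (map xAt (range i n))
    ... | no _ = 0#

    Δ𝓗 : Subset n → Subset n → Carrier
    Δ𝓗 Rs Cs = det 𝓗 (elems Rs) (elems Cs)

    vdm : Subset n → Subset n → Carrier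
    vdm K I = det (λ k i → pow (xAt k) i) (elems K) (elems I)

    frakF : Subset n → Subset n → Carrier
    frakF J K = sum (map term (filter (λ I → ∣ I ∣ N.≟ ∣ J ∣) (allSubsets n)))
      where
      term : Subset n → Carrier
      term I = neg1^ (foldr _+ℕ_ 0 (elems I)) * (Δ𝓗 (∁ J) (star (∁ I)) * vdm K I)

    -- entries of A_{J,K}: rows inj₁ k (k ∈ K) give the block B_{J,K},
    -- rows inj₂ b (b ∈ [n]∖J) give the block C_{J,K}
    Aentry : ℕ ⊎ ℕ → ℕ → Carrier
    Aentry (inj₁ k) j = pow (xAt k) (suc n ∸ j)
    Aentry (inj₂ b) j = 𝓗 b j

    detA : Subset n → Subset n → Carrier
    detA J K = det Aentry (map inj₁ (elems K) ++ map inj₂ (elems (∁ J))) (range 1 n)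

{-# OPTIONS --safe #-}
-- Expanding det A_{J,K} by the generalised Laplace rule along its first r rows writes it as a signed
-- sum, over r-sets of columns, of a minor of B_{J,K} times the complementary minor of C_{J,K}. Once
-- the column order is reversed, the columns chosen for B are exactly the exponents I, so that minor is
-- det(x_k^i)_{k∈K,i∈I}, while the complementary minor is Δ_{[n]-J,([n]-I)^*}(𝓗) with its columns
-- reversed. The Laplace sign of I differs from (-1)^{Σ I} by a factor that only depends on |I| = |K|,
-- so all terms of 𝔉_{J,K} occur with one common sign. The Laplace rule itself follows by induction on
-- the rows, since expanding along one row commutes with expanding along the remaining block.
module Submission where

open import Defs
open import Level using (Level; _⊔_)
open import Algebra.Bundles using (CommutativeRing)
open import Data.Bool using (Bool; true; false; not)
open import Data.Empty using (⊥-elim)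
open import Data.Fin using (Fin)
open import Data.Fin.Subset using (Subset; ∁; ∣_∣)
open import Data.List using (List; []; _∷_; _++_; _∷ʳ_; length; map; reverse; upTo; filter)
import Data.List.Properties as List
open import Data.Nat using (ℕ; zero; suc; _∸_) renaming (_+_ to _+ℕ_)
open import Data.Nat.ListAction using () renaming (sum to sumℕ)
import Data.Nat.Properties as ℕ
open import Data.Nat.Tactic.RingSolver using (solve-∀)
open import Data.Product using (Σ; _,_; _×_; proj₁; proj₂)
open import Data.Sum using (_⊎_; inj₁; inj₂)
open import Data.Vec using ()
  renaming ([] to []ᵛ; _∷_ to _∷ᵛ_; reverse to reverseᵛ; _∷ʳ_ to _∷ʳᵛ_)
import Data.Vec.Properties as Vec
open import Function using (_∘_; _∋_)
open import Relation.Nullary using (¬_; yes; no)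
open import Relation.Unary using (Pred; Decidable)
import Relation.Binary.PropositionalEquality as ≡
open ≡ using (_≡_; _≢_)

triangular : ℕ → ℕ
triangular zero    = 0
triangular (suc m) = m +ℕ triangular m

isEven : ℕ → Bool
isEven zero    = true
isEven (suc m) = not (isEven m)

select : ∀ {a} {X : Set a} {m} → Subset m → List X → List X
select []ᵛ          _        = []
select (_ ∷ᵛ _)     []       = []
select (true ∷ᵛ S)  (x ∷ xs) = x ∷ select S xs
select (false ∷ᵛ S) (x ∷ xs) = select S xs

-- the number of pairs i < j with i ∉ S and j ∈ S
crossings : ∀ {m} → Subset m → ℕ
crossings []ᵛ          = 0
crossings (true ∷ᵛ S)  = crossings S
crossings (false ∷ᵛ S) = crossings S +ℕ length (elems S)

-- reversing all m columns, then the size corrections of the two complementary minors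
signExponent : ∀ {m} → Subset m → Subset m → ℕ
signExponent {m} J K =
  triangular m +ℕ ((length (elems K) +ℕ triangular (length (elems K)))
                   +ℕ triangular (length (elems (∁ J))))

module _ where
  open ≡.≡-Reasoning

  length-elems : ∀ {m} (S : Subset m) → length (elems S) ≡ ∣ S ∣
  length-elems []ᵛ          = ≡.refl
  length-elems (true ∷ᵛ S)  = ≡.cong suc (≡.trans (List.length-map suc (elems S)) (length-elems S))
  length-elems (false ∷ᵛ S) = ≡.trans (List.length-map suc (elems S)) (length-elems S)

  length-select : ∀ {a} {X : Set a} {m} (S : Subset m) (xs : List X) →
                  length xs ≡ m → length (select S xs) ≡ length (elems S)
  length-select []ᵛ          []       _  = ≡.refl
  length-select (true ∷ᵛ S)  (x ∷ xs) eq =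
    ≡.cong suc (≡.trans (length-select S xs (ℕ.suc-injective eq)) (≡.sym (List.length-map suc (elems S))))
  length-select (false ∷ᵛ S) (x ∷ xs) eq =
    ≡.trans (length-select S xs (ℕ.suc-injective eq)) (≡.sym (List.length-map suc (elems S)))

  select-map : ∀ {a b} {X : Set a} {Y : Set b} {m} (S : Subset m) (f : X → Y) xs →
               select S (map f xs) ≡ map f (select S xs)
  select-map []ᵛ          f _        = ≡.refl
  select-map (_ ∷ᵛ _)     f []       = ≡.refl
  select-map (true ∷ᵛ S)  f (x ∷ xs) = ≡.cong (f x ∷_) (select-map S f xs)
  select-map (false ∷ᵛ S) f (x ∷ xs) = select-map S f xs

  select-∷ʳ : ∀ {a} {X : Set a} {m} (S : Subset m) b (xs : List X) y → length xs ≡ m →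
              select (S ∷ʳᵛ b) (xs ∷ʳ y) ≡ select S xs ++ select (b ∷ᵛ []ᵛ) (y ∷ [])
  select-∷ʳ []ᵛ          b []       y _  = ≡.refl
  select-∷ʳ (true ∷ᵛ S)  b (x ∷ xs) y eq = ≡.cong (x ∷_) (select-∷ʳ S b xs y (ℕ.suc-injective eq))
  select-∷ʳ (false ∷ᵛ S) b (x ∷ xs) y eq = select-∷ʳ S b xs y (ℕ.suc-injective eq)

  select-reverse : ∀ {a} {X : Set a} {m} (S : Subset m) (xs : List X) → length xs ≡ m →
                   select (reverseᵛ S) (reverse xs) ≡ reverse (select S xs)
  select-reverse []ᵛ      []       _  = ≡.refl
  select-reverse (b ∷ᵛ S) (x ∷ xs) eq = begin
    select (reverseᵛ (b ∷ᵛ S)) (reverse (x ∷ xs))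
      ≡⟨ ≡.cong₂ select (Vec.reverse-∷ b S) (List.unfold-reverse x xs) ⟩
    select (reverseᵛ S ∷ʳᵛ b) (reverse xs ∷ʳ x)
      ≡⟨ select-∷ʳ (reverseᵛ S) b (reverse xs) x (≡.trans (List.length-reverse xs) (ℕ.suc-injective eq)) ⟩
    select (reverseᵛ S) (reverse xs) ++ select (b ∷ᵛ []ᵛ) (x ∷ [])
      ≡⟨ ≡.cong (_++ _) (select-reverse S xs (ℕ.suc-injective eq)) ⟩
    reverse (select S xs) ++ select (b ∷ᵛ []ᵛ) (x ∷ [])
      ≡⟨ reverse-head b ⟩
    reverse (select (b ∷ᵛ S) (x ∷ xs)) ∎
    where
    reverse-head : ∀ b → reverse (select S xs) ++ select (b ∷ᵛ []ᵛ) (x ∷ []) ≡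
                         reverse (select (b ∷ᵛ S) (x ∷ xs))
    reverse-head true  = ≡.sym (List.unfold-reverse x (select S xs))
    reverse-head false = List.++-identityʳ _

  reverse-∷-++ : ∀ {a} {X : Set a} (x : X) xs ys → reverse (x ∷ xs) ++ ys ≡ reverse xs ++ x ∷ ys
  reverse-∷-++ x xs ys = ≡.trans (≡.sym (List.ʳ++-defn (x ∷ xs))) (List.ʳ++-defn xs)

  range-suc : ∀ m → range 1 (suc m) ≡ 1 ∷ map suc (range 1 m)
  range-suc m = ≡.cong (λ xs → 1 ∷ map suc xs) (≡.sym (List.map-upTo suc m))

  range-∷ʳ : ∀ m → range 1 (suc m) ≡ range 1 m ∷ʳ suc m
  range-∷ʳ m = ≡.trans (≡.cong (map suc) (≡.sym (List.upTo-∷ʳ m))) (List.map-++ suc (upTo m) (m ∷ []))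

  length-range : ∀ m → length (range 1 m) ≡ m
  length-range m = ≡.trans (List.length-map suc (upTo m)) (List.length-upTo m)

  reverse-range : ∀ m → reverse (range 1 m) ≡ map (suc m ∸_) (range 1 m)
  reverse-range zero    = ≡.refl
  reverse-range (suc m) = begin
    reverse (range 1 (suc m))                           ≡⟨ ≡.cong reverse (range-∷ʳ m) ⟩
    reverse (range 1 m ∷ʳ suc m)                        ≡⟨ List.reverse-++ (range 1 m) (suc m ∷ []) ⟩
    suc m ∷ reverse (range 1 m)                         ≡⟨ ≡.cong (suc m ∷_) (reverse-range m) ⟩
    suc m ∷ map (suc m ∸_) (range 1 m)
      ≡⟨ ≡.cong (suc m ∷_) (List.map-∘ {g = suc (suc m) ∸_} {f = suc} (range 1 m)) ⟩
    map (suc (suc m) ∸_) (1 ∷ map suc (range 1 m))      ≡⟨ ≡.cong (map (suc (suc m) ∸_)) (≡.sym (range-suc m)) ⟩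
    map (suc (suc m) ∸_) (range 1 (suc m))              ∎

  select-range : ∀ {m} (S : Subset m) → select S (range 1 m) ≡ elems S
  select-range []ᵛ               = ≡.refl
  select-range {suc m} (b ∷ᵛ S) = ≡.trans (≡.cong (select (b ∷ᵛ S)) (range-suc m)) (head b)
    where
    shifted : select S (map suc (range 1 m)) ≡ map suc (elems S)
    shifted = ≡.trans (select-map S suc (range 1 m)) (≡.cong (map suc) (select-range S))
    head : ∀ b → select (b ∷ᵛ S) (1 ∷ map suc (range 1 m)) ≡ elems (b ∷ᵛ S)
    head true  = ≡.cong (1 ∷_) shifted
    head false = shifted

  map-∸-elems : ∀ {m} (S : Subset m) → map (suc m ∸_) (elems S) ≡ reverse (elems (star S))
  map-∸-elems {m} S = begin
    map (suc m ∸_) (elems S)                              ≡⟨ ≡.cong (map (suc m ∸_)) (≡.sym (select-range S)) ⟩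
    map (suc m ∸_) (select S (range 1 m))                 ≡⟨ ≡.sym (select-map S (suc m ∸_) (range 1 m)) ⟩
    select S (map (suc m ∸_) (range 1 m))                 ≡⟨ ≡.cong (select S) (≡.sym (reverse-range m)) ⟩
    select S (reverse (range 1 m))
      ≡⟨ ≡.cong (λ T → select T (reverse (range 1 m))) (≡.sym (Vec.reverse-involutive S)) ⟩
    select (reverseᵛ (star S)) (reverse (range 1 m))      ≡⟨ select-reverse (star S) (range 1 m) (length-range m) ⟩
    reverse (select (star S) (range 1 m))                 ≡⟨ ≡.cong reverse (select-range (star S)) ⟩
    reverse (elems (star S))                              ∎

  map-∸-elems-involutive : ∀ {m} (S : Subset m) → map (suc m ∸_) (map (suc m ∸_) (elems S)) ≡ elems S
  map-∸-elems-involutive {m} S = begin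
    map (suc m ∸_) (map (suc m ∸_) (elems S))             ≡⟨ ≡.cong (map (suc m ∸_)) (map-∸-elems S) ⟩
    map (suc m ∸_) (reverse (elems (star S)))             ≡⟨ List.reverse-map (suc m ∸_) (elems (star S)) ⟩
    reverse (map (suc m ∸_) (elems (star S)))             ≡⟨ ≡.cong reverse (map-∸-elems (star S)) ⟩
    reverse (reverse (elems (star (star S))))             ≡⟨ List.reverse-involutive _ ⟩
    elems (star (star S))                                 ≡⟨ ≡.cong elems (Vec.reverse-involutive S) ⟩
    elems S                                               ∎

  sum-map-suc : ∀ xs → sumℕ (map suc xs) ≡ sumℕ xs +ℕ length xs
  sum-map-suc []       = ≡.refl
  sum-map-suc (x ∷ xs) = ≡.trans (≡.cong (suc x +ℕ_) (sum-map-suc xs)) (shift x (sumℕ xs) (length xs))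
    where
    shift : ∀ x s l → suc x +ℕ (s +ℕ l) ≡ (x +ℕ s) +ℕ suc l
    shift = solve-∀

  -- Each element of S exceeds its rank in S by the number of non-elements before it.
  sum-elems : ∀ {m} (S : Subset m) →
              sumℕ (elems S) ≡ crossings S +ℕ (length (elems S) +ℕ triangular (length (elems S)))
  sum-elems []ᵛ          = ≡.refl
  sum-elems (true ∷ᵛ S)  = begin
    suc (sumℕ (map suc (elems S)))                   ≡⟨ ≡.cong suc (sum-map-suc (elems S)) ⟩
    suc (sumℕ (elems S) +ℕ l)                        ≡⟨ ≡.cong (λ s → suc (s +ℕ l)) (sum-elems S) ⟩
    suc ((crossings S +ℕ (l +ℕ triangular l)) +ℕ l)  ≡⟨ regroup (crossings S) l (triangular l) ⟩
    crossings S +ℕ (suc l +ℕ (l +ℕ triangular l))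
      ≡⟨ ≡.cong (λ k → crossings S +ℕ (suc k +ℕ triangular (suc k))) (≡.sym (List.length-map suc (elems S))) ⟩
    crossings (true ∷ᵛ S) +ℕ (length (elems (true ∷ᵛ S)) +ℕ triangular (length (elems (true ∷ᵛ S)))) ∎
    where
    l : ℕ
    l = length (elems S)
    regroup : ∀ c l t → suc ((c +ℕ (l +ℕ t)) +ℕ l) ≡ c +ℕ (suc l +ℕ (l +ℕ t))
    regroup = solve-∀
  sum-elems (false ∷ᵛ S) = begin
    sumℕ (map suc (elems S))                   ≡⟨ sum-map-suc (elems S) ⟩
    sumℕ (elems S) +ℕ l                        ≡⟨ ≡.cong (_+ℕ l) (sum-elems S) ⟩
    (crossings S +ℕ (l +ℕ triangular l)) +ℕ l  ≡⟨ regroup (crossings S) l (triangular l) ⟩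
    (crossings S +ℕ l) +ℕ (l +ℕ triangular l)
      ≡⟨ ≡.cong (λ k → (crossings S +ℕ l) +ℕ (k +ℕ triangular k)) (≡.sym (List.length-map suc (elems S))) ⟩
    crossings (false ∷ᵛ S) +ℕ (length (elems (false ∷ᵛ S)) +ℕ triangular (length (elems (false ∷ᵛ S)))) ∎
    where
    l : ℕ
    l = length (elems S)
    regroup : ∀ c l t → (c +ℕ (l +ℕ t)) +ℕ l ≡ (c +ℕ l) +ℕ (l +ℕ t)
    regroup = solve-∀

module Determinant {c ℓ : Level} (R : CommutativeRing c ℓ) where
  open CommutativeRing R
  open WithRing R
  open import Algebra.Properties.Ring ring
    using (-0#≈0#; -‿involutive; -‿+-comm; -‿distribˡ-*; -‿distribʳ-*; -1*x≈-x; x[y-z]≈xy-xz)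
  open import Algebra.Properties.CommutativeSemigroup +-commutativeSemigroup
    using (interchange) renaming (x∙yz≈y∙xz to x+[y+z]≈y+[x+z])
  open import Algebra.Properties.CommutativeSemigroup *-commutativeSemigroup
    using () renaming (x∙yz≈y∙xz to x*[y*z]≈y*[x*z])
  open import Algebra.Solver.Ring.NaturalCoefficients.Default commutativeSemiring
    using (solve; _:=_; _:+_; _:*_)
  open import Relation.Binary.Reasoning.Setoid setoid

  -‿*-cancel : ∀ x y → - x * - y ≈ x * y
  -‿*-cancel x y =
    trans (sym (-‿distribˡ-* x (- y))) (trans (-‿cong (sym (-‿distribʳ-* x y))) (-‿involutive (x * y)))

  *-neg-sub : ∀ a u p → a * - u - - p ≈ - (a * u - p)
  *-neg-sub a u p = trans (+-congʳ (sym (-‿distribʳ-* a u))) (-‿+-comm (a * u) (- p))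

  neg1^-+ : ∀ m k → neg1^ (m +ℕ k) ≈ neg1^ m * neg1^ k
  neg1^-+ zero    k = sym (*-identityˡ (neg1^ k))
  neg1^-+ (suc m) k = trans (-‿cong (neg1^-+ m k)) (-‿distribˡ-* (neg1^ m) (neg1^ k))

  neg1^-square : ∀ m → neg1^ m * neg1^ m ≈ 1#
  neg1^-square zero    = *-identityˡ 1#
  neg1^-square (suc m) = trans (-‿*-cancel (neg1^ m) (neg1^ m)) (neg1^-square m)

  sign-isEven : ∀ m → sign (isEven m) ≈ neg1^ m
  sign-isEven zero    = refl
  sign-isEven (suc m) = trans (sign-not (isEven m)) (-‿cong (sign-isEven m))
    where
    sign-not : ∀ b → sign (not b) ≈ - sign b
    sign-not true  = refl
    sign-not false = sym (-‿involutive 1#)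

  module _ {b} {B : Set b} where

    -- rowExpand f g xs = Σₖ (-1)ᵏ f xₖ g (xs without xₖ)
    rowExpand : (B → Carrier) → (List B → Carrier) → List B → Carrier
    rowExpand f g []       = 0#
    rowExpand f g (x ∷ xs) = f x * g xs - rowExpand f (g ∘ (x ∷_)) xs

    -- blockExpand g h xs = Σ ± g S * h T over the splittings of xs into complementary sublists
    -- S and T, the sign counting the pairs in which an element of T precedes one of S
    blockExpand : (List B → Carrier) → (List B → Carrier) → List B → Carrier
    blockExpand g h []       = g [] * h []
    blockExpand g h (x ∷ xs) =
      blockExpand (g ∘ (x ∷_)) h xs + blockExpand (λ S → neg1^ (length S) * g S) (h ∘ (x ∷_)) xs

    rowExpand-cong : ∀ {f g g′} xs → (∀ S → suc (length S) ≡ length xs → g S ≈ g′ S) →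
                     rowExpand f g xs ≈ rowExpand f g′ xs
    rowExpand-cong []       _  = refl
    rowExpand-cong (x ∷ xs) eq =
      +-cong (*-congˡ (eq xs ≡.refl)) (-‿cong (rowExpand-cong xs (λ S e → eq (x ∷ S) (≡.cong suc e))))

    rowExpand-zero : ∀ f xs → rowExpand f (λ _ → 0#) xs ≈ 0#
    rowExpand-zero f []       = refl
    rowExpand-zero f (x ∷ xs) = begin
      f x * 0# - rowExpand f (λ _ → 0#) xs   ≈⟨ +-cong (zeroʳ (f x)) (-‿cong (rowExpand-zero f xs)) ⟩
      0# - 0#                                ≈⟨ -‿inverseʳ 0# ⟩
      0#                                     ∎

    rowExpand-+ : ∀ f g g′ xs → rowExpand f (λ S → g S + g′ S) xs ≈ rowExpand f g xs + rowExpand f g′ xs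
    rowExpand-+ f g g′ []       = sym (+-identityʳ 0#)
    rowExpand-+ f g g′ (x ∷ xs) = begin
      f x * (g xs + g′ xs) - rowExpand f (λ S → g (x ∷ S) + g′ (x ∷ S)) xs
        ≈⟨ +-congˡ (-‿cong (rowExpand-+ f (g ∘ (x ∷_)) (g′ ∘ (x ∷_)) xs)) ⟩
      f x * (g xs + g′ xs) - (rowExpand f (g ∘ (x ∷_)) xs + rowExpand f (g′ ∘ (x ∷_)) xs)
        ≈⟨ +-cong (distribˡ (f x) (g xs) (g′ xs)) (sym (-‿+-comm _ _)) ⟩
      (f x * g xs + f x * g′ xs) + (- rowExpand f (g ∘ (x ∷_)) xs + - rowExpand f (g′ ∘ (x ∷_)) xs)
        ≈⟨ interchange _ _ _ _ ⟩
      rowExpand f g (x ∷ xs) + rowExpand f g′ (x ∷ xs) ∎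

    rowExpand-neg : ∀ f g xs → rowExpand f (λ S → - g S) xs ≈ - rowExpand f g xs
    rowExpand-neg f g []       = sym -0#≈0#
    rowExpand-neg f g (x ∷ xs) =
      trans (+-congˡ (-‿cong (rowExpand-neg f (g ∘ (x ∷_)) xs))) (*-neg-sub (f x) (g xs) _)

    rowExpand-sign : ∀ f g xs →
      neg1^ (length xs) * rowExpand f g xs ≈ - rowExpand f (λ S → neg1^ (length S) * g S) xs
    rowExpand-sign f g []       = trans (zeroʳ 1#) (sym -0#≈0#)
    rowExpand-sign f g (x ∷ xs) = begin
      - s * (f x * g xs - rowExpand f g₁ xs)                ≈⟨ x[y-z]≈xy-xz (- s) _ _ ⟩
      - s * (f x * g xs) - - s * rowExpand f g₁ xs
        ≈⟨ +-cong (trans (sym (-‿distribˡ-* s _)) (-‿cong (x*[y*z]≈y*[x*z] s (f x) (g xs))))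
                  (-‿cong (trans (sym (-‿distribˡ-* s _)) (-‿cong (rowExpand-sign f g₁ xs)))) ⟩
      - (f x * (s * g xs)) - - - Q                          ≈⟨ -‿+-comm _ _ ⟩
      - (f x * (s * g xs) - - Q)                            ≈⟨ -‿cong (+-congˡ (-‿cong (sym shifted))) ⟩
      - rowExpand f (λ S → neg1^ (length S) * g S) (x ∷ xs) ∎
      where
      s : Carrier
      s = neg1^ (length xs)
      g₁ : List B → Carrier
      g₁ = g ∘ (x ∷_)
      Q : Carrier
      Q = rowExpand f (λ S → neg1^ (length S) * g₁ S) xs
      shifted : rowExpand f (λ S → - neg1^ (length S) * g₁ S) xs ≈ - Q
      shifted = trans (rowExpand-cong xs (λ S _ → sym (-‿distribˡ-* _ _))) (rowExpand-neg f _ xs)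

    rowExpand-swap : ∀ f g a b → (∀ ps qs → g (ps ++ a ∷ b ∷ qs) ≈ - g (ps ++ b ∷ a ∷ qs)) →
                     ∀ ps qs → rowExpand f g (ps ++ a ∷ b ∷ qs) ≈ - rowExpand f g (ps ++ b ∷ a ∷ qs)
    rowExpand-swap f g a b swapped [] qs = begin
      X - (Y - rowExpand f (λ S → g (a ∷ b ∷ S)) qs)
        ≈⟨ +-congˡ (-‿cong (+-congˡ (-‿cong inner))) ⟩
      X - (Y - - Z)
        ≈⟨ +-congˡ (trans (sym (-‿+-comm Y (- - Z))) (+-congˡ (-‿involutive (- Z)))) ⟩
      X + (- Y + - Z)
        ≈⟨ x+[y+z]≈y+[x+z] X (- Y) (- Z) ⟩
      - Y + (X - Z)
        ≈⟨ trans (+-congˡ (sym (-‿involutive _))) (-‿+-comm Y _) ⟩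
      - (Y - (X - Z)) ∎
      where
      X Y Z : Carrier
      X = f a * g (b ∷ qs)
      Y = f b * g (a ∷ qs)
      Z = rowExpand f (λ S → g (b ∷ a ∷ S)) qs
      inner : rowExpand f (λ S → g (a ∷ b ∷ S)) qs ≈ - Z
      inner = trans (rowExpand-cong qs (λ S _ → swapped [] S)) (rowExpand-neg f _ qs)
    rowExpand-swap f g a b swapped (p ∷ ps) qs = begin
      f p * g (ps ++ a ∷ b ∷ qs) - rowExpand f (g ∘ (p ∷_)) (ps ++ a ∷ b ∷ qs)
        ≈⟨ +-cong (*-congˡ (swapped ps qs))
                  (-‿cong (rowExpand-swap f (g ∘ (p ∷_)) a b (swapped ∘ (p ∷_)) ps qs)) ⟩
      f p * - g (ps ++ b ∷ a ∷ qs) - - rowExpand f (g ∘ (p ∷_)) (ps ++ b ∷ a ∷ qs)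
        ≈⟨ *-neg-sub (f p) _ _ ⟩
      - rowExpand f g ((p ∷ ps) ++ b ∷ a ∷ qs) ∎

    blockExpand-cong : ∀ {g g′} h xs → (∀ S → g S ≈ g′ S) → blockExpand g h xs ≈ blockExpand g′ h xs
    blockExpand-cong h []       eq = *-congʳ (eq [])
    blockExpand-cong h (x ∷ xs) eq =
      +-cong (blockExpand-cong h xs (eq ∘ (x ∷_))) (blockExpand-cong (h ∘ (x ∷_)) xs (λ S → *-congˡ (eq S)))

    blockExpand-zero : ∀ h xs → blockExpand (λ _ → 0#) h xs ≈ 0#
    blockExpand-zero h []       = zeroˡ (h [])
    blockExpand-zero h (x ∷ xs) = begin
      blockExpand (λ _ → 0#) h xs + blockExpand (λ S → neg1^ (length S) * 0#) (h ∘ (x ∷_)) xs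
        ≈⟨ +-cong (blockExpand-zero h xs)
                  (trans (blockExpand-cong _ xs (λ S → zeroʳ _)) (blockExpand-zero _ xs)) ⟩
      0# + 0#
        ≈⟨ +-identityˡ 0# ⟩
      0# ∎

    blockExpand-+ : ∀ g g′ h xs →
                    blockExpand (λ S → g S + g′ S) h xs ≈ blockExpand g h xs + blockExpand g′ h xs
    blockExpand-+ g g′ h []       = distribʳ (h []) (g []) (g′ [])
    blockExpand-+ g g′ h (x ∷ xs) = begin
      blockExpand (λ S → g (x ∷ S) + g′ (x ∷ S)) h xs +
      blockExpand (λ S → neg1^ (length S) * (g S + g′ S)) h₁ xs
        ≈⟨ +-cong (blockExpand-+ _ _ h xs)
                  (trans (blockExpand-cong h₁ xs (λ S → distribˡ _ _ _)) (blockExpand-+ _ _ h₁ xs)) ⟩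
      (blockExpand (g ∘ (x ∷_)) h xs + blockExpand (g′ ∘ (x ∷_)) h xs) +
      (blockExpand (λ S → neg1^ (length S) * g S) h₁ xs + blockExpand (λ S → neg1^ (length S) * g′ S) h₁ xs)
        ≈⟨ interchange _ _ _ _ ⟩
      blockExpand g h (x ∷ xs) + blockExpand g′ h (x ∷ xs) ∎
      where
      h₁ : List B → Carrier
      h₁ = h ∘ (x ∷_)

    blockExpand-* : ∀ a g h xs → blockExpand (λ S → a * g S) h xs ≈ a * blockExpand g h xs
    blockExpand-* a g h []       = *-assoc a (g []) (h [])
    blockExpand-* a g h (x ∷ xs) = begin
      blockExpand (λ S → a * g (x ∷ S)) h xs +
      blockExpand (λ S → neg1^ (length S) * (a * g S)) (h ∘ (x ∷_)) xs
        ≈⟨ +-cong (blockExpand-* a _ h xs)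
                  (trans (blockExpand-cong _ xs (λ S → x*[y*z]≈y*[x*z] _ a (g S))) (blockExpand-* a _ _ xs)) ⟩
      a * blockExpand (g ∘ (x ∷_)) h xs + a * blockExpand (λ S → neg1^ (length S) * g S) (h ∘ (x ∷_)) xs
        ≈⟨ sym (distribˡ a _ _) ⟩
      a * blockExpand g h (x ∷ xs) ∎

    blockExpand-neg : ∀ g h xs → blockExpand (λ S → - g S) h xs ≈ - blockExpand g h xs
    blockExpand-neg g h xs = begin
      blockExpand (λ S → - g S) h xs       ≈⟨ blockExpand-cong h xs (λ S → sym (-1*x≈-x (g S))) ⟩
      blockExpand (λ S → - 1# * g S) h xs  ≈⟨ blockExpand-* (- 1#) g h xs ⟩
      - 1# * blockExpand g h xs            ≈⟨ -1*x≈-x _ ⟩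
      - blockExpand g h xs                 ∎

    rowExpand-blockExpand : ∀ f (g h : List B → Carrier) xs →
                            rowExpand f (blockExpand g h) xs ≈ blockExpand (rowExpand f g) h xs
    rowExpand-blockExpand f g h []       = sym (zeroˡ (h []))
    rowExpand-blockExpand f g h (x ∷ xs) = begin
      f x * blockExpand g h xs - rowExpand f (λ S → blockExpand g₁ h S + blockExpand g₂ h₁ S) xs
        ≈⟨ +-congˡ (-‿cong (rowExpand-+ f _ _ xs)) ⟩
      f x * blockExpand g h xs - (rowExpand f (blockExpand g₁ h) xs + rowExpand f (blockExpand g₂ h₁) xs)
        ≈⟨ +-congˡ (-‿cong (+-cong (rowExpand-blockExpand f g₁ h xs) (rowExpand-blockExpand f g₂ h₁ xs))) ⟩
      f x * blockExpand g h xs - (blockExpand (rowExpand f g₁) h xs + blockExpand (rowExpand f g₂) h₁ xs)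
        ≈⟨ trans (+-congˡ (sym (-‿+-comm _ _))) (sym (+-assoc _ _ _)) ⟩
      (f x * blockExpand g h xs - blockExpand (rowExpand f g₁) h xs) - blockExpand (rowExpand f g₂) h₁ xs
        ≈⟨ +-cong (sym first) (sym second) ⟩
      blockExpand (rowExpand f g) h (x ∷ xs) ∎
      where
      g₁ g₂ h₁ : List B → Carrier
      g₁ = g ∘ (x ∷_)
      g₂ = λ S → neg1^ (length S) * g S
      h₁ = h ∘ (x ∷_)
      first : blockExpand (λ S → f x * g S - rowExpand f g₁ S) h xs ≈
              f x * blockExpand g h xs - blockExpand (rowExpand f g₁) h xs
      first = trans (blockExpand-+ _ _ h xs) (+-cong (blockExpand-* (f x) g h xs) (blockExpand-neg _ h xs))
      second : blockExpand (λ S → neg1^ (length S) * rowExpand f g S) h₁ xs ≈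
               - blockExpand (rowExpand f g₂) h₁ xs
      second = trans (blockExpand-cong h₁ xs (λ S → rowExpand-sign f g S)) (blockExpand-neg _ h₁ xs)

  rowExpand-map : ∀ {b b′} {B : Set b} {B′ : Set b′}
                  (f : B → Carrier) (g : List B → Carrier) (k : B′ → B) xs →
                  rowExpand f g (map k xs) ≈ rowExpand (f ∘ k) (g ∘ map k) xs
  rowExpand-map f g k []       = refl
  rowExpand-map f g k (x ∷ xs) = +-congˡ (-‿cong (rowExpand-map f (g ∘ (k x ∷_)) k xs))

  module _ {a b} {A : Set a} {B : Set b} where

    expand≈rowExpand : ∀ (M : A → B → Carrier) r rs (E : ℕ → List B → B → List B → Carrier) →
      (∀ k before y → E k before y [] ≈ neg1^ k * (M r y * det M rs (reverse before))) →
      (∀ k before y z zs → E k before y (z ∷ zs) ≈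
         neg1^ k * (M r y * det M rs (reverse before ++ z ∷ zs)) + E (suc k) (y ∷ before) z zs) →
      ∀ k before y ys →
      E k before y ys ≈ neg1^ k * rowExpand (M r) (λ S → det M rs (reverse before ++ S)) (y ∷ ys)
    expand≈rowExpand M r rs E onNil onCons k before y [] = trans (onNil k before y) (*-congˡ (begin
      M r y * det M rs (reverse before)
        ≡⟨ ≡.cong (λ S → M r y * det M rs S) (≡.sym (List.++-identityʳ _)) ⟩
      M r y * det M rs (reverse before ++ [])
        ≈⟨ sym (trans (+-congˡ -0#≈0#) (+-identityʳ _)) ⟩
      M r y * det M rs (reverse before ++ []) - 0# ∎))
    expand≈rowExpand M r rs E onNil onCons k before y (z ∷ zs) = begin
      E k before y (z ∷ zs)
        ≈⟨ onCons k before y z zs ⟩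
      s * (M r y * G (z ∷ zs)) + E (suc k) (y ∷ before) z zs
        ≈⟨ +-congˡ (expand≈rowExpand M r rs E onNil onCons (suc k) (y ∷ before) z zs) ⟩
      s * (M r y * G (z ∷ zs)) + - s * rowExpand (M r) (λ S → det M rs (reverse (y ∷ before) ++ S)) (z ∷ zs)
        ≈⟨ +-congˡ (*-congˡ (rowExpand-cong (z ∷ zs)
             (λ S _ → reflexive (≡.cong (det M rs) (reverse-∷-++ y before S))))) ⟩
      s * (M r y * G (z ∷ zs)) + - s * rowExpand (M r) (G ∘ (y ∷_)) (z ∷ zs)
        ≈⟨ +-congˡ (trans (sym (-‿distribˡ-* s _)) (-‿distribʳ-* s _)) ⟩
      s * (M r y * G (z ∷ zs)) + s * - rowExpand (M r) (G ∘ (y ∷_)) (z ∷ zs)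
        ≈⟨ sym (distribˡ s _ _) ⟩
      s * rowExpand (M r) G (y ∷ z ∷ zs) ∎
      where
      s : Carrier
      s = neg1^ k
      G : List B → Carrier
      G S = det M rs (reverse before ++ S)

    -- `det` expands along the first row through a function local to its definition. Abstracting
    -- the arguments of that call makes it a pattern, so unification solves the left side of E≡ by it;
    -- the columns come in as a pair so that they stay out of the context of that metavariable.
    det-firstRow : ∀ (M : A → B → Carrier) r rs cs → det M (r ∷ rs) cs ≈ rowExpand (M r) (det M rs) cs
    det-firstRow M r rs []       = refl
    det-firstRow M r rs (x ∷ xs) = expansion (x , xs)
      where
      Expander : Set (b ⊔ c)
      Expander = ℕ → List B → B → List B → Carrier
      lhs : ∀ {E E′ : Expander} → E ≡ E′ → Expander
      lhs {E} _ = E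
      atStart : ∀ {k before y ys} → 0 ≡ k → [] ≡ before →
                neg1^ k * rowExpand (M r) (λ S → det M rs (reverse before ++ S)) (y ∷ ys) ≈
                rowExpand (M r) (det M rs) (y ∷ ys)
      atStart ≡.refl ≡.refl = *-identityˡ _
      expansion : (p : B × List B) →
                  det M (r ∷ rs) (proj₁ p ∷ proj₂ p) ≈ rowExpand (M r) (det M rs) (proj₁ p ∷ proj₂ p)
      expansion p with 0 in k≡ | (List B ∋ []) in before≡ | proj₁ p | proj₂ p | (Expander ∋ _) in E≡
      ... | k | before | y | ys | _ =
        trans (expand≈rowExpand M r rs (lhs E≡) (λ _ _ _ → refl) (λ _ _ _ _ _ → refl) k before y ys)
              (atStart k≡ before≡)

    det-vanishes : ∀ (M : A → B → Carrier) rs cs → length rs ≢ length cs → det M rs cs ≈ 0#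
    det-vanishes M []       []      ne = ⊥-elim (ne ≡.refl)
    det-vanishes M []       (_ ∷ _) ne = refl
    det-vanishes M (r ∷ rs) cs      ne = begin
      det M (r ∷ rs) cs                ≈⟨ det-firstRow M r rs cs ⟩
      rowExpand (M r) (det M rs) cs
        ≈⟨ rowExpand-cong cs (λ S eq → det-vanishes M rs S (λ e → ne (≡.trans (≡.cong suc e) eq))) ⟩
      rowExpand (M r) (λ _ → 0#) cs    ≈⟨ rowExpand-zero (M r) cs ⟩
      0#                               ∎

    -- Minors of mismatched size vanish.
    det-length-scale : ∀ (M : A → B → Carrier) (φ : ℕ → Carrier) rs cs →
                       φ (length cs) * det M rs cs ≈ φ (length rs) * det M rs cs
    det-length-scale M φ rs cs with length rs ℕ.≟ length cs
    ... | yes eq = *-congʳ (reflexive (≡.cong φ (≡.sym eq)))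
    ... | no ne  = trans (*-congˡ vanishes) (trans (zeroʳ _) (sym (trans (*-congˡ vanishes) (zeroʳ _))))
      where
      vanishes : det M rs cs ≈ 0#
      vanishes = det-vanishes M rs cs ne

    blockExpand-det-nil : ∀ (M : A → B → Carrier) h cs → blockExpand (det M []) h cs ≈ h cs
    blockExpand-det-nil M h []       = *-identityˡ (h [])
    blockExpand-det-nil M h (x ∷ xs) = begin
      blockExpand (λ S → det M [] (x ∷ S)) h xs +
      blockExpand (λ S → neg1^ (length S) * det M [] S) (h ∘ (x ∷_)) xs
        ≈⟨ +-cong (blockExpand-zero h xs) (trans (blockExpand-cong _ xs unsigned) (blockExpand-det-nil M _ xs)) ⟩
      0# + h (x ∷ xs)
        ≈⟨ +-identityˡ _ ⟩
      h (x ∷ xs) ∎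
      where
      unsigned : ∀ S → neg1^ (length S) * det M [] S ≈ det M [] S
      unsigned []      = *-identityˡ 1#
      unsigned (_ ∷ _) = zeroʳ _

    laplace : ∀ (M : A → B → Carrier) R₁ R₂ cs →
              det M (R₁ ++ R₂) cs ≈ blockExpand (det M R₁) (det M R₂) cs
    laplace M []       R₂ cs = sym (blockExpand-det-nil M (det M R₂) cs)
    laplace M (r ∷ R₁) R₂ cs = begin
      det M (r ∷ R₁ ++ R₂) cs                                 ≈⟨ det-firstRow M r (R₁ ++ R₂) cs ⟩
      rowExpand (M r) (det M (R₁ ++ R₂)) cs                   ≈⟨ rowExpand-cong cs (λ S _ → laplace M R₁ R₂ S) ⟩
      rowExpand (M r) (blockExpand (det M R₁) (det M R₂)) cs  ≈⟨ rowExpand-blockExpand (M r) _ _ cs ⟩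
      blockExpand (rowExpand (M r) (det M R₁)) (det M R₂) cs
        ≈⟨ blockExpand-cong _ cs (λ S → sym (det-firstRow M r R₁ S)) ⟩
      blockExpand (det M (r ∷ R₁)) (det M R₂) cs              ∎

    det-swap : ∀ (M : A → B → Carrier) rs ps a b qs →
               det M rs (ps ++ a ∷ b ∷ qs) ≈ - det M rs (ps ++ b ∷ a ∷ qs)
    det-swap M []       ps a b qs = trans (nil ps) (sym (trans (-‿cong (nil ps)) -0#≈0#))
      where
      nil : ∀ ps {y ys} → det M [] (ps ++ y ∷ ys) ≈ 0#
      nil []      = refl
      nil (_ ∷ _) = refl
    det-swap M (r ∷ rs) ps a b qs = begin
      det M (r ∷ rs) (ps ++ a ∷ b ∷ qs)
        ≈⟨ det-firstRow M r rs (ps ++ a ∷ b ∷ qs) ⟩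
      rowExpand (M r) (det M rs) (ps ++ a ∷ b ∷ qs)
        ≈⟨ rowExpand-swap (M r) (det M rs) a b (λ ps′ qs′ → det-swap M rs ps′ a b qs′) ps qs ⟩
      - rowExpand (M r) (det M rs) (ps ++ b ∷ a ∷ qs)
        ≈⟨ -‿cong (sym (det-firstRow M r rs (ps ++ b ∷ a ∷ qs))) ⟩
      - det M (r ∷ rs) (ps ++ b ∷ a ∷ qs) ∎

    det-move : ∀ (M : A → B → Carrier) rs ps cs x ys →
               det M rs (ps ++ cs ++ x ∷ ys) ≈ neg1^ (length cs) * det M rs (ps ++ x ∷ cs ++ ys)
    det-move M rs ps []       x ys = sym (*-identityˡ _)
    det-move M rs ps (d ∷ cs) x ys = begin
      det M rs (ps ++ d ∷ cs ++ x ∷ ys)         ≡⟨ ≡.cong (det M rs) (≡.sym (List.++-assoc ps (d ∷ []) _)) ⟩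
      det M rs ((ps ∷ʳ d) ++ cs ++ x ∷ ys)      ≈⟨ det-move M rs (ps ∷ʳ d) cs x ys ⟩
      s * det M rs ((ps ∷ʳ d) ++ x ∷ cs ++ ys)  ≡⟨ ≡.cong (λ L → s * det M rs L) (List.++-assoc ps (d ∷ []) _) ⟩
      s * det M rs (ps ++ d ∷ x ∷ cs ++ ys)     ≈⟨ *-congˡ (det-swap M rs ps d x (cs ++ ys)) ⟩
      s * - det M rs (ps ++ x ∷ d ∷ cs ++ ys)   ≈⟨ trans (sym (-‿distribʳ-* s _)) (-‿distribˡ-* s _) ⟩
      - s * det M rs (ps ++ x ∷ (d ∷ cs) ++ ys) ∎
      where
      s : Carrier
      s = neg1^ (length cs)

    det-reverse-++ : ∀ (M : A → B → Carrier) rs cs ys →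
                     det M rs (reverse cs ++ ys) ≈ neg1^ (triangular (length cs)) * det M rs (cs ++ ys)
    det-reverse-++ M rs []       ys = sym (*-identityˡ _)
    det-reverse-++ M rs (x ∷ cs) ys = begin
      det M rs (reverse (x ∷ cs) ++ ys)  ≡⟨ ≡.cong (det M rs) (reverse-∷-++ x cs ys) ⟩
      det M rs (reverse cs ++ x ∷ ys)    ≈⟨ det-reverse-++ M rs cs (x ∷ ys) ⟩
      t * det M rs (cs ++ x ∷ ys)        ≈⟨ *-congˡ (det-move M rs [] cs x ys) ⟩
      t * (s * det M rs (x ∷ cs ++ ys))  ≈⟨ sym (*-assoc t s _) ⟩
      (t * s) * det M rs (x ∷ cs ++ ys)  ≈⟨ *-congʳ (trans (*-comm t s) (sym (neg1^-+ (length cs) _))) ⟩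
      neg1^ (triangular (length (x ∷ cs))) * det M rs ((x ∷ cs) ++ ys) ∎
      where
      s t : Carrier
      s = neg1^ (length cs)
      t = neg1^ (triangular (length cs))

    det-reverse : ∀ (M : A → B → Carrier) rs cs →
                  det M rs (reverse cs) ≈ neg1^ (triangular (length cs)) * det M rs cs
    det-reverse M rs cs = ≡.subst₂ (λ L L′ → det M rs L ≈ neg1^ (triangular (length cs)) * det M rs L′)
      (List.++-identityʳ (reverse cs)) (List.++-identityʳ cs) (det-reverse-++ M rs cs [])

  det-map-rows : ∀ {a a′ b} {A : Set a} {A′ : Set a′} {B : Set b}
                 (M : A → B → Carrier) (k : A′ → A) rs cs → det M (map k rs) cs ≈ det (M ∘ k) rs cs
  det-map-rows M k []       []      = refl
  det-map-rows M k []       (_ ∷ _) = refl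
  det-map-rows M k (r ∷ rs) cs      = begin
    det M (k r ∷ map k rs) cs                  ≈⟨ det-firstRow M (k r) (map k rs) cs ⟩
    rowExpand (M (k r)) (det M (map k rs)) cs  ≈⟨ rowExpand-cong cs (λ S _ → det-map-rows M k rs S) ⟩
    rowExpand (M (k r)) (det (M ∘ k) rs) cs    ≈⟨ sym (det-firstRow (M ∘ k) r rs cs) ⟩
    det (M ∘ k) (r ∷ rs) cs                    ∎

  det-map-columns : ∀ {a b b′} {A : Set a} {B : Set b} {B′ : Set b′}
                    (M : A → B → Carrier) (k : B′ → B) rs cs →
                    det M rs (map k cs) ≈ det (λ r → M r ∘ k) rs cs
  det-map-columns M k []       []      = refl
  det-map-columns M k []       (_ ∷ _) = refl
  det-map-columns M k (r ∷ rs) cs      = begin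
    det M (r ∷ rs) (map k cs)                        ≈⟨ det-firstRow M r rs (map k cs) ⟩
    rowExpand (M r) (det M rs) (map k cs)            ≈⟨ rowExpand-map (M r) (det M rs) k cs ⟩
    rowExpand (M r ∘ k) (det M rs ∘ map k) cs        ≈⟨ rowExpand-cong cs (λ S _ → det-map-columns M k rs S) ⟩
    rowExpand (M r ∘ k) (det (λ r → M r ∘ k) rs) cs  ≈⟨ sym (det-firstRow (λ r → M r ∘ k) r rs cs) ⟩
    det (λ r → M r ∘ k) (r ∷ rs) cs                  ∎

  sum-++ : ∀ xs ys → sum (xs ++ ys) ≈ sum xs + sum ys
  sum-++ []       ys = sym (+-identityˡ _)
  sum-++ (x ∷ xs) ys = trans (+-congˡ (sum-++ xs ys)) (sym (+-assoc _ _ _))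

  module _ {a} {X : Set a} where

    sum-map-cong : ∀ {f g : X → Carrier} xs → (∀ x → f x ≈ g x) → sum (map f xs) ≈ sum (map g xs)
    sum-map-cong []       _  = refl
    sum-map-cong (x ∷ xs) eq = +-cong (eq x) (sum-map-cong xs eq)

    sum-map-* : ∀ k (f : X → Carrier) xs → sum (map (λ x → k * f x) xs) ≈ k * sum (map f xs)
    sum-map-* k f []       = sym (zeroʳ k)
    sum-map-* k f (x ∷ xs) = trans (+-congˡ (sum-map-* k f xs)) (sym (distribˡ k _ _))

    sum-filter : ∀ {p} {P : Pred X p} (P? : Decidable P) (f : X → Carrier) xs →
                 (∀ x → ¬ P x → f x ≈ 0#) → sum (map f (filter P? xs)) ≈ sum (map f xs)
    sum-filter P? f []       _    = refl
    sum-filter P? f (x ∷ xs) vanishes with P? x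
    ... | yes _  = +-congˡ (sum-filter P? f xs vanishes)
    ... | no ¬px =
      trans (sum-filter P? f xs vanishes) (sym (trans (+-congʳ (vanishes x ¬px)) (+-identityˡ _)))

  module _ {a} {X : Set a} where

    subsetTerm : ∀ {m} → (List X → Carrier) → (List X → Carrier) → List X → Subset m → Carrier
    subsetTerm g h xs S = neg1^ (crossings S) * (g (select S xs) * h (select (∁ S) xs))

    blockExpand-subsets : ∀ {m} (g h : List X → Carrier) xs → length xs ≡ m →
                          blockExpand g h xs ≈ sum (map (subsetTerm g h xs) (allSubsets m))
    blockExpand-subsets g h []       ≡.refl = sym (trans (+-identityʳ _) (*-identityˡ _))
    blockExpand-subsets {suc m} g h (x ∷ xs) eq = begin
      blockExpand (g ∘ (x ∷_)) h xs + blockExpand g₂ (h ∘ (x ∷_)) xs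
        ≈⟨ +-cong (blockExpand-subsets _ _ xs eq′) (blockExpand-subsets _ _ xs eq′) ⟩
      sum (map (F ∘ (true ∷ᵛ_)) A) + sum (map (subsetTerm g₂ (h ∘ (x ∷_)) xs) A)
        ≈⟨ +-congˡ (sum-map-cong A moved) ⟩
      sum (map (F ∘ (true ∷ᵛ_)) A) + sum (map (F ∘ (false ∷ᵛ_)) A)
        ≡⟨ ≡.cong₂ (λ u v → sum u + sum v) (List.map-∘ A) (List.map-∘ A) ⟩
      sum (map F (map (true ∷ᵛ_) A)) + sum (map F (map (false ∷ᵛ_) A))
        ≈⟨ sym (sum-++ (map F (map (true ∷ᵛ_) A)) (map F (map (false ∷ᵛ_) A))) ⟩
      sum (map F (map (true ∷ᵛ_) A) ++ map F (map (false ∷ᵛ_) A))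
        ≡⟨ ≡.cong sum (≡.sym (List.map-++ F (map (true ∷ᵛ_) A) (map (false ∷ᵛ_) A))) ⟩
      sum (map F (allSubsets (suc m))) ∎
      where
      eq′ : length xs ≡ m
      eq′ = ℕ.suc-injective eq
      A : List (Subset m)
      A = allSubsets m
      F : Subset (suc m) → Carrier
      F = subsetTerm g h (x ∷ xs)
      g₂ : List X → Carrier
      g₂ S = neg1^ (length S) * g S
      moved : ∀ S → subsetTerm g₂ (h ∘ (x ∷_)) xs S ≈ F (false ∷ᵛ S)
      moved S = begin
        neg1^ (crossings S) * ((neg1^ (length (select S xs)) * g T) * h (x ∷ T′))
          ≡⟨ ≡.cong (λ k → neg1^ (crossings S) * ((neg1^ k * g T) * h (x ∷ T′))) (length-select S xs eq′) ⟩
        neg1^ (crossings S) * ((neg1^ (length (elems S)) * g T) * h (x ∷ T′))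
          ≈⟨ regroup _ _ _ _ ⟩
        (neg1^ (crossings S) * neg1^ (length (elems S))) * (g T * h (x ∷ T′))
          ≈⟨ *-congʳ (sym (neg1^-+ (crossings S) _)) ⟩
        F (false ∷ᵛ S) ∎
        where
        T T′ : List X
        T  = select S xs
        T′ = select (∁ S) xs
        regroup : ∀ p q u v → p * ((q * u) * v) ≈ (p * q) * (u * v)
        regroup = solve 4 (λ p q u v → p :* ((q :* u) :* v) := (p :* q) :* (u :* v)) refl

  neg1^-crossings : ∀ {m} (S : Subset m) →
    neg1^ (crossings S) ≈ neg1^ (sumℕ (elems S)) * neg1^ (length (elems S) +ℕ triangular (length (elems S)))
  neg1^-crossings S = begin
    neg1^ κ                                  ≈⟨ sym (*-identityʳ _) ⟩
    neg1^ κ * 1#                             ≈⟨ *-congˡ (sym (neg1^-square w)) ⟩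
    neg1^ κ * (neg1^ w * neg1^ w)            ≈⟨ sym (*-assoc _ _ _) ⟩
    (neg1^ κ * neg1^ w) * neg1^ w            ≈⟨ *-congʳ (sym (neg1^-+ κ w)) ⟩
    neg1^ (κ +ℕ w) * neg1^ w                 ≡⟨ ≡.cong (λ k → neg1^ k * neg1^ w) (≡.sym (sum-elems S)) ⟩
    neg1^ (sumℕ (elems S)) * neg1^ w         ∎
    where
    κ w : ℕ
    κ = crossings S
    w = length (elems S) +ℕ triangular (length (elems S))

  module _ {n : ℕ} (x : Fin n → Carrier) (J K : Subset n) where
    open Vars x

    reflect : ℕ → ℕ
    reflect = suc n ∸_

    -- Listed backwards, the columns of B_{J,K} carry the powers x_k^1, …, x_k^n in this order.
    columns : List ℕ
    columns = map reflect (range 1 n)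

    Krows Jrows : List (ℕ ⊎ ℕ)
    Krows = map inj₁ (elems K)
    Jrows = map inj₂ (elems (∁ J))

    summand : Subset n → Carrier
    summand I = neg1^ (sumℕ (elems I)) * (Δ𝓗 (∁ J) (star (∁ I)) * vdm K I)

    minorSignExponent : ℕ
    minorSignExponent =
      (length (elems K) +ℕ triangular (length (elems K))) +ℕ triangular (length (elems (∁ J)))

    length-columns : length columns ≡ n
    length-columns = ≡.trans (List.length-map reflect (range 1 n)) (length-range n)

    select-columns : ∀ S → select S columns ≡ map reflect (elems S)
    select-columns S = ≡.trans (select-map S reflect (range 1 n)) (≡.cong (map reflect) (select-range S))

    detA-reversed : detA J K ≈ neg1^ (triangular n) * det Aentry (Krows ++ Jrows) columns
    detA-reversed = begin
      det Aentry (Krows ++ Jrows) (range 1 n)        ≡⟨ ≡.cong (det Aentry (Krows ++ Jrows)) range≡ ⟩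
      det Aentry (Krows ++ Jrows) (reverse columns)  ≈⟨ det-reverse Aentry (Krows ++ Jrows) columns ⟩
      neg1^ (triangular (length columns)) * det Aentry (Krows ++ Jrows) columns
        ≡⟨ ≡.cong (λ k → neg1^ (triangular k) * det Aentry (Krows ++ Jrows) columns) length-columns ⟩
      neg1^ (triangular n) * det Aentry (Krows ++ Jrows) columns ∎
      where
      range≡ : range 1 n ≡ reverse columns
      range≡ = ≡.trans (≡.sym (List.reverse-involutive (range 1 n))) (≡.cong reverse (reverse-range n))

    Krows-minor : ∀ I → det Aentry Krows (map reflect (elems I)) ≈ vdm K I
    Krows-minor I = begin
      det Aentry Krows (map reflect (elems I))
        ≈⟨ det-map-rows Aentry inj₁ (elems K) _ ⟩
      det (λ k j → pow (xAt k) (reflect j)) (elems K) (map reflect (elems I))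
        ≈⟨ sym (det-map-columns (λ k → pow (xAt k)) reflect (elems K) _) ⟩
      det (λ k → pow (xAt k)) (elems K) (map reflect (map reflect (elems I)))
        ≡⟨ ≡.cong (det (λ k → pow (xAt k)) (elems K)) (map-∸-elems-involutive I) ⟩
      vdm K I ∎

    Jrows-minor : ∀ I → det Aentry Jrows (map reflect (elems (∁ I))) ≈
                        neg1^ (triangular (length (elems (star (∁ I))))) * Δ𝓗 (∁ J) (star (∁ I))
    Jrows-minor I = begin
      det Aentry Jrows (map reflect (elems (∁ I)))          ≈⟨ det-map-rows Aentry inj₂ (elems (∁ J)) _ ⟩
      det 𝓗 (elems (∁ J)) (map reflect (elems (∁ I)))      ≡⟨ ≡.cong (det 𝓗 (elems (∁ J))) (map-∸-elems (∁ I)) ⟩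
      det 𝓗 (elems (∁ J)) (reverse (elems (star (∁ I))))  ≈⟨ det-reverse 𝓗 (elems (∁ J)) _ ⟩
      neg1^ (triangular (length (elems (star (∁ I))))) * Δ𝓗 (∁ J) (star (∁ I)) ∎

    subsetTerm≈summand : ∀ I → subsetTerm (det Aentry Krows) (det Aentry Jrows) columns I ≈
                               neg1^ minorSignExponent * summand I
    subsetTerm≈summand I = begin
      neg1^ (crossings I) * (det Aentry Krows (select I columns) * det Aentry Jrows (select (∁ I) columns))
        ≡⟨ ≡.cong₂ (λ u v → neg1^ (crossings I) * (det Aentry Krows u * det Aentry Jrows v))
                   (select-columns I) (select-columns (∁ I)) ⟩
      neg1^ (crossings I) * (det Aentry Krows (map reflect (elems I)) *
                             det Aentry Jrows (map reflect (elems (∁ I))))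
        ≈⟨ *-cong (neg1^-crossings I) (*-cong (Krows-minor I) (Jrows-minor I)) ⟩
      (p * neg1^ (w (length (elems I)))) * (vdm K I * (neg1^ (triangular ℓ′) * Δ))
        ≈⟨ regroup₁ _ _ _ _ _ ⟩
      p * ((neg1^ (w (length (elems I))) * vdm K I) * (neg1^ (triangular ℓ′) * Δ))
        ≈⟨ *-congˡ (*-cong (det-length-scale _ (neg1^ ∘ w) (elems K) (elems I))
                           (det-length-scale 𝓗 (neg1^ ∘ triangular) (elems (∁ J)) (elems (star (∁ I))))) ⟩
      p * ((neg1^ (w (length (elems K))) * vdm K I) * (neg1^ (triangular (length (elems (∁ J)))) * Δ))
        ≈⟨ regroup₂ _ _ _ _ _ ⟩
      (neg1^ (w (length (elems K))) * neg1^ (triangular (length (elems (∁ J))))) * summand I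
        ≈⟨ *-congʳ (sym (neg1^-+ (w (length (elems K))) _)) ⟩
      neg1^ minorSignExponent * summand I ∎
      where
      p Δ : Carrier
      p = neg1^ (sumℕ (elems I))
      Δ = Δ𝓗 (∁ J) (star (∁ I))
      ℓ′ : ℕ
      ℓ′ = length (elems (star (∁ I)))
      w : ℕ → ℕ
      w k = k +ℕ triangular k
      regroup₁ : ∀ p q v t d → (p * q) * (v * (t * d)) ≈ p * ((q * v) * (t * d))
      regroup₁ = solve 5 (λ p q v t d → (p :* q) :* (v :* (t :* d)) := p :* ((q :* v) :* (t :* d))) refl
      regroup₂ : ∀ p q v t d → p * ((q * v) * (t * d)) ≈ (q * t) * (p * (d * v))
      regroup₂ = solve 5 (λ p q v t d → p :* ((q :* v) :* (t :* d)) := (q :* t) :* (p :* (d :* v))) refl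

    detA-expansion :
      detA J K ≈ neg1^ (triangular n) * (neg1^ minorSignExponent * sum (map summand (allSubsets n)))
    detA-expansion = begin
      detA J K
        ≈⟨ detA-reversed ⟩
      neg1^ (triangular n) * det Aentry (Krows ++ Jrows) columns
        ≈⟨ *-congˡ (laplace Aentry Krows Jrows columns) ⟩
      neg1^ (triangular n) * blockExpand (det Aentry Krows) (det Aentry Jrows) columns
        ≈⟨ *-congˡ (blockExpand-subsets _ _ columns length-columns) ⟩
      neg1^ (triangular n) * sum (map (subsetTerm (det Aentry Krows) (det Aentry Jrows) columns) (allSubsets n))
        ≈⟨ *-congˡ (trans (sum-map-cong (allSubsets n) subsetTerm≈summand)
                          (sum-map-* _ summand (allSubsets n))) ⟩
      neg1^ (triangular n) * (neg1^ minorSignExponent * sum (map summand (allSubsets n))) ∎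

    frakF-expansion : ∣ J ∣ ≡ ∣ K ∣ → frakF J K ≈ sum (map summand (allSubsets n))
    frakF-expansion ∣J∣≡∣K∣ = sum-filter (λ I → ∣ I ∣ ℕ.≟ ∣ J ∣) summand (allSubsets n) vanishes
      where
      vanishes : ∀ I → ∣ I ∣ ≢ ∣ J ∣ → summand I ≈ 0#
      vanishes I ne =
        trans (*-congˡ (trans (*-congˡ (det-vanishes _ (elems K) (elems I) sizes)) (zeroʳ _))) (zeroʳ _)
        where
        sizes : length (elems K) ≢ length (elems I)
        sizes e =
          ne (≡.sym (≡.trans ∣J∣≡∣K∣ (≡.trans (≡.sym (length-elems K)) (≡.trans e (length-elems I)))))

    frakF≈sign*detA : ∣ J ∣ ≡ ∣ K ∣ → frakF J K ≈ sign (isEven (signExponent J K)) * detA J K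
    frakF≈sign*detA ∣J∣≡∣K∣ = sym (begin
      sign (isEven (signExponent J K)) * detA J K
        ≈⟨ *-cong (trans (sign-isEven (signExponent J K)) (neg1^-+ (triangular n) minorSignExponent))
                  detA-expansion ⟩
      (a * b) * (a * (b * S))
        ≈⟨ regroup a b S ⟩
      ((a * a) * (b * b)) * S
        ≈⟨ *-congʳ (trans (*-cong (neg1^-square (triangular n)) (neg1^-square minorSignExponent))
                          (*-identityˡ 1#)) ⟩
      1# * S
        ≈⟨ *-identityˡ S ⟩
      S
        ≈⟨ sym (frakF-expansion ∣J∣≡∣K∣) ⟩
      frakF J K ∎)
      where
      a b S : Carrier
      a = neg1^ (triangular n)
      b = neg1^ minorSignExponent
      S = sum (map summand (allSubsets n))
      regroup : ∀ a b s → (a * b) * (a * (b * s)) ≈ ((a * a) * (b * b)) * s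
      regroup = solve 3 (λ a b s → (a :* b) :* (a :* (b :* s)) := ((a :* a) :* (b :* b)) :* s) refl

lemma4p5 : {c ℓ : Level} (n : ℕ) (J K : Subset n) → ∣ J ∣ ≡ ∣ K ∣ →
    Σ Bool (λ s → (R : CommutativeRing c ℓ) (x : Fin n → CommutativeRing.Carrier R) →
      CommutativeRing._≈_ R (WithRing.Vars.frakF R x J K)
        (CommutativeRing._*_ R (WithRing.sign R s) (WithRing.Vars.detA R x J K)))
lemma4p5 n J K ∣J∣≡∣K∣ =
  isEven (signExponent J K) , λ R x → Determinant.frakF≈sign*detA R x J K ∣J∣≡∣K∣
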